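{- Let $A_1,A_2$ be distinct point-hyperplane anti-flags of $\mathrm{PG}(n-1,\mathbb{F})$ ($\mathbb{F}$ a field, $n\ge 3$), and let $\{A_1,A_2\}^{\sim_3}$ be the set of anti-flags $3$-adjacent to both $A_1$ and $A_2$. Then: (1) if $A_1\sim_1A_2$, then $|\{A_1,A_2\}^{\sim_3}|=1$; (2) if $A_1\sim_2A_2$, then $|\{A_1,A_2\}^{\sim_3}|=0$; (3) if $A_1\sim_4A_2$, then $|\{A_1,A_2\}^{\sim_3}|=2$.
   Context: An anti-flag is a pair $(p,H)$ of a point $p$ and a hyperplane $H$ of $\mathrm{PG}(n-1,\mathbb{F})$ with $p\notin H$. For distinct anti-flags $A_1=(p_1,H_1)$, $A_2=(p_2,H_2)$: $A_1\sim_1 A_2$ iff $p_j\in H_{3-j}$ and $p_{3-j}\notin H_j$ for some $j\in\{1,2\}$; $A_1\sim_2 A_2$ iff $p_j\in H_{3-j}$ for each $j$; $A_1\sim_3 A_2$ iff $p_1=p_2$ or $H_1=H_2$; $A_1\sim_4A_2$ iff $p_1\ne p_2$, $H_1\neq H_2$ and $p_j\notin H_{3-j}$ for each $j$. Anti-flags are $i$-adjacent if they are related by $\sim_i$. -}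

module Defs where

open import Level using (Level; _⊔_) renaming (suc to lsuc)
open import Data.Nat using (ℕ; zero; suc)
open import Data.Fin using (Fin)
open import Data.Product using (Σ; ∃; _×_; _,_; proj₁; proj₂)
open import Data.Sum using (_⊎_)
open import Relation.Nullary using (¬_)
open import Algebra.Bundles using (CommutativeRing)

record Field (c ℓ : Level) : Set (lsuc (c ⊔ ℓ)) where
  field
    commutativeRing : CommutativeRing c ℓ
  open CommutativeRing commutativeRing public
  field
    0≉1     : ¬ (0# ≈ 1#)
    inverse : ∀ x → ¬ (x ≈ 0#) → ∃ λ y → x * y ≈ 1#

-- The projective space PG(n-1, F): points are nonzero vectors of F^n up to
-- nonzero scalars; hyperplanes are kernels of nonzero linear forms, given by
-- their nonzero coefficient vectors up to nonzero scalars.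
module ProjectiveSpace {c ℓ : Level} (F : Field c ℓ) (n : ℕ) where
  open Field F using (Carrier; _≈_; _+_; _*_; 0#)

  Vector : Set c
  Vector = Fin n → Carrier

  sumF : ∀ {m} → (Fin m → Carrier) → Carrier
  sumF {ℕ.zero}  f = 0#
  sumF {ℕ.suc m} f = f Fin.zero + sumF (λ i → f (Fin.suc i))

  apply : Vector → Vector → Carrier
  apply a v = sumF (λ i → a i * v i)

  NonZeroVec : Vector → Set ℓ
  NonZeroVec v = ¬ (∀ i → v i ≈ 0#)

  _∼ᵥ_ : Vector → Vector → Set (c ⊔ ℓ)
  u ∼ᵥ v = ∃ λ (k : Carrier) → ¬ (k ≈ 0#) × (∀ i → u i ≈ k * v i)

  Point : Set (c ⊔ ℓ)
  Point = Σ Vector NonZeroVec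

  Hyperplane : Set (c ⊔ ℓ)
  Hyperplane = Σ Vector NonZeroVec

  _≐ₚ_ : Point → Point → Set (c ⊔ ℓ)
  p ≐ₚ q = proj₁ p ∼ᵥ proj₁ q

  _≐ₕ_ : Hyperplane → Hyperplane → Set (c ⊔ ℓ)
  H ≐ₕ K = proj₁ H ∼ᵥ proj₁ K

  _∈ₕ_ : Point → Hyperplane → Set ℓ
  p ∈ₕ H = apply (proj₁ H) (proj₁ p) ≈ 0#

  AntiFlag : Set (c ⊔ ℓ)
  AntiFlag = Σ (Point × Hyperplane) λ pH → ¬ (proj₁ pH ∈ₕ proj₂ pH)

  pt : AntiFlag → Point
  pt A = proj₁ (proj₁ A)

  hp : AntiFlag → Hyperplane
  hp A = proj₂ (proj₁ A)

  _≐_ : AntiFlag → AntiFlag → Set (c ⊔ ℓ)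
  A ≐ B = (pt A ≐ₚ pt B) × (hp A ≐ₕ hp B)

  Distinct : AntiFlag → AntiFlag → Set (c ⊔ ℓ)
  Distinct A B = ¬ (A ≐ B)

  _∼₁_ : AntiFlag → AntiFlag → Set (c ⊔ ℓ)
  A ∼₁ B = Distinct A B ×
    (((pt A ∈ₕ hp B) × ¬ (pt B ∈ₕ hp A)) ⊎ ((pt B ∈ₕ hp A) × ¬ (pt A ∈ₕ hp B)))

  _∼₂_ : AntiFlag → AntiFlag → Set (c ⊔ ℓ)
  A ∼₂ B = Distinct A B × (pt A ∈ₕ hp B) × (pt B ∈ₕ hp A)

  _∼₃_ : AntiFlag → AntiFlag → Set (c ⊔ ℓ)
  A ∼₃ B = Distinct A B × ((pt A ≐ₚ pt B) ⊎ (hp A ≐ₕ hp B))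

  _∼₄_ : AntiFlag → AntiFlag → Set (c ⊔ ℓ)
  A ∼₄ B = Distinct A B × ¬ (pt A ≐ₚ pt B) × ¬ (hp A ≐ₕ hp B)
           × ¬ (pt A ∈ₕ hp B) × ¬ (pt B ∈ₕ hp A)

  Common₃ : AntiFlag → AntiFlag → AntiFlag → Set (c ⊔ ℓ)
  Common₃ A₁ A₂ X = (X ∼₃ A₁) × (X ∼₃ A₂)

  -- cardinalities of a (≐-closed) set of anti-flags, counted up to ≐
  HasNone : (AntiFlag → Set (c ⊔ ℓ)) → Set (c ⊔ ℓ)
  HasNone S = ∀ X → ¬ S X

  HasExactlyOne : (AntiFlag → Set (c ⊔ ℓ)) → Set (c ⊔ ℓ)
  HasExactlyOne S = ∃ λ X → S X × (∀ Y → S Y → Y ≐ X)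

  HasExactlyTwo : (AntiFlag → Set (c ⊔ ℓ)) → Set (c ⊔ ℓ)
  HasExactlyTwo S = ∃ λ X → ∃ λ Y → S X × S Y × Distinct X Y
                      × (∀ Z → S Z → (Z ≐ X) ⊎ (Z ≐ Y))

{-# OPTIONS --safe #-}
-- A common 3-neighbour X of A₁ = (p₁,H₁) and A₂ = (p₂,H₂) shares its point
-- or its hyperplane with each of them. As soon as p₁ ≠ p₂ and H₁ ≠ H₂, X can
-- share neither the point nor the hyperplane with both, so X is one of the two
-- crossings (p₁,H₂) and (p₂,H₁), and a crossing is an anti-flag exactly when
-- its point is off its hyperplane. An incidence p₁ ∈ H₂ forces p₁ ≠ p₂ and
-- H₁ ≠ H₂, so this applies to ∼₁ and ∼₂ as well as ∼₄, and counting the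
-- non-incidences among p₁ ∉ H₂, p₂ ∉ H₁ gives 1, 0 and 2.
module Submission where

open import Defs
open import Data.Nat using (ℕ; zero; suc; _≤_)
open import Data.Fin using (Fin)
open import Data.Product using (∃; _×_; _,_; proj₂; map₂; swap)
open import Data.Sum using (_⊎_; inj₁; inj₂; [_,_]′; map)
open import Data.Empty using (⊥-elim)
open import Level using (Level; _⊔_)
open import Relation.Nullary using (¬_)
import Algebra.Properties.CommutativeSemigroup as CommutativeSemigroupProperties
import Algebra.Properties.Monoid as MonoidProperties
import Relation.Binary.Reasoning.Setoid as SetoidReasoning

module FieldProperties {c ℓ : Level} (F : Field c ℓ) where
  open Field F
  open MonoidProperties *-monoid using (cancelˡ)

  inverseˡ : ∀ x → ¬ (x ≈ 0#) → ∃ λ y → y * x ≈ 1#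
  inverseˡ x x≉0 = map₂ (trans (*-comm _ x)) (inverse x x≉0)

  inverse-≉0 : ∀ {x y} → y * x ≈ 1# → ¬ (y ≈ 0#)
  inverse-≉0 {x} yx≈1 y≈0 = 0≉1 (trans (sym (trans (*-congʳ y≈0) (zeroˡ x))) yx≈1)

  *-≉0 : ∀ {x y} → ¬ (x ≈ 0#) → ¬ (y ≈ 0#) → ¬ (x * y ≈ 0#)
  *-≉0 {x} {y} x≉0 y≉0 xy≈0 =
    let x⁻¹ , x⁻¹x≈1 = inverseˡ x x≉0
    in y≉0 (begin
      y              ≈⟨ cancelˡ x⁻¹x≈1 y ⟨
      x⁻¹ * (x * y)  ≈⟨ *-congˡ xy≈0 ⟩
      x⁻¹ * 0#       ≈⟨ zeroʳ x⁻¹ ⟩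
      0#             ∎)
    where open SetoidReasoning setoid

module AntiFlagProperties {c ℓ : Level} (F : Field c ℓ) (n : ℕ) where
  open ProjectiveSpace F n
  open Field F
  open FieldProperties F
  open MonoidProperties *-monoid using (cancelˡ)
  open CommutativeSemigroupProperties *-commutativeSemigroup using (interchange)
  open SetoidReasoning setoid

  sumF-scale : ∀ {m} {f g : Fin m → Carrier} k →
               (∀ i → f i ≈ k * g i) → sumF f ≈ k * sumF g
  sumF-scale {zero}  k f≈kg = sym (zeroʳ k)
  sumF-scale {suc m} k f≈kg = trans
    (+-cong (f≈kg Fin.zero) (sumF-scale k (λ i → f≈kg (Fin.suc i))))
    (sym (distribˡ k _ _))

  ∼ᵥ-refl : ∀ {u} → u ∼ᵥ u
  ∼ᵥ-refl = 1# , (λ 1≈0 → 0≉1 (sym 1≈0)) , (λ i → sym (*-identityˡ _))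

  ∼ᵥ-sym : ∀ {u v} → u ∼ᵥ v → v ∼ᵥ u
  ∼ᵥ-sym {v = v} (k , k≉0 , u≈kv) =
    let k⁻¹ , k⁻¹k≈1 = inverseˡ k k≉0
    in k⁻¹ , inverse-≉0 k⁻¹k≈1 ,
       λ i → trans (sym (cancelˡ k⁻¹k≈1 (v i))) (*-congˡ (sym (u≈kv i)))

  ∼ᵥ-trans : ∀ {u v w} → u ∼ᵥ v → v ∼ᵥ w → u ∼ᵥ w
  ∼ᵥ-trans {w = w} (k , k≉0 , u≈kv) (m , m≉0 , v≈mw) =
    k * m , *-≉0 k≉0 m≉0 ,
    λ i → trans (u≈kv i) (trans (*-congˡ (v≈mw i)) (sym (*-assoc k m (w i))))

  apply≈0-resp : ∀ {a a' v v'} → a ∼ᵥ a' → v ∼ᵥ v' → apply a v ≈ 0# → apply a' v' ≈ 0#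
  apply≈0-resp {a} {a'} {v} {v'} a∼a' v∼v' av≈0 with ∼ᵥ-sym a∼a' | ∼ᵥ-sym v∼v'
  ... | m , _ , a'≈ma | k , _ , v'≈kv = begin
    apply a' v'          ≈⟨ sumF-scale (m * k) termwise ⟩
    (m * k) * apply a v  ≈⟨ *-congˡ av≈0 ⟩
    (m * k) * 0#         ≈⟨ zeroʳ (m * k) ⟩
    0#                   ∎
    where
    termwise : ∀ i → a' i * v' i ≈ (m * k) * (a i * v i)
    termwise i = trans (*-cong (a'≈ma i) (v'≈kv i)) (interchange m _ k _)

  Skew : AntiFlag → AntiFlag → Set (c ⊔ ℓ)
  Skew A B = ¬ (pt A ≐ₚ pt B) × ¬ (hp A ≐ₕ hp B)

  Skew-sym : ∀ A B → Skew A B → Skew B A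
  Skew-sym _ _ (p≉ , H≉) = (λ e → p≉ (∼ᵥ-sym e)) , (λ f → H≉ (∼ᵥ-sym f))

  incident⇒skew : ∀ A B → pt A ∈ₕ hp B → Skew A B
  incident⇒skew A B pA∈HB =
    (λ pA≐pB → proj₂ B (apply≈0-resp ∼ᵥ-refl pA≐pB pA∈HB)) ,
    (λ HA≐HB → proj₂ A (apply≈0-resp (∼ᵥ-sym HA≐HB) ∼ᵥ-refl pA∈HB))

  crossing : (A B : AntiFlag) → ¬ (pt A ∈ₕ hp B) → AntiFlag
  crossing A B pA∉HB = (pt A , hp B) , pA∉HB

  crossing-Common₃ : ∀ A B → Skew A B → (pA∉HB : ¬ (pt A ∈ₕ hp B)) →
                     Common₃ A B (crossing A B pA∉HB)
  crossing-Common₃ _ _ (p≉ , H≉) _ =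
    ((λ (_ , f) → H≉ (∼ᵥ-sym f)) , inj₁ ∼ᵥ-refl) ,
    ((λ (e , _) → p≉ e) , inj₂ ∼ᵥ-refl)

  Common₃⇒crossing : ∀ A B X → Skew A B → Common₃ A B X →
    (∃ λ pA∉HB → X ≐ crossing A B pA∉HB) ⊎ (∃ λ pB∉HA → X ≐ crossing B A pB∉HA)
  Common₃⇒crossing _ _ _ (p≉ , _) ((_ , inj₁ e₁) , (_ , inj₁ e₂)) =
    ⊥-elim (p≉ (∼ᵥ-trans (∼ᵥ-sym e₁) e₂))
  Common₃⇒crossing _ _ X _ ((_ , inj₁ e₁) , (_ , inj₂ f₂)) =
    inj₁ ((λ pA∈HB → proj₂ X (apply≈0-resp (∼ᵥ-sym f₂) (∼ᵥ-sym e₁) pA∈HB)) , e₁ , f₂)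
  Common₃⇒crossing _ _ X _ ((_ , inj₂ f₁) , (_ , inj₁ e₂)) =
    inj₂ ((λ pB∈HA → proj₂ X (apply≈0-resp (∼ᵥ-sym f₁) (∼ᵥ-sym e₂) pB∈HA)) , e₂ , f₁)
  Common₃⇒crossing _ _ _ (_ , H≉) ((_ , inj₂ f₁) , (_ , inj₂ f₂)) =
    ⊥-elim (H≉ (∼ᵥ-trans (∼ᵥ-sym f₁) f₂))

  incident-nonincident⇒HasExactlyOne : ∀ A B → pt A ∈ₕ hp B → ¬ (pt B ∈ₕ hp A) →
                                       HasExactlyOne (Common₃ A B)
  incident-nonincident⇒HasExactlyOne A B pA∈HB pB∉HA =
    crossing B A pB∉HA ,
    swap (crossing-Common₃ B A (Skew-sym A B skew) pB∉HA) ,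
    λ Y Y∈ → [ (λ (pA∉HB , _) → ⊥-elim (pA∉HB pA∈HB)) , proj₂ ]′
                (Common₃⇒crossing A B Y skew Y∈)
    where
    skew : Skew A B
    skew = incident⇒skew A B pA∈HB

  ∼₁⇒HasExactlyOne : ∀ A B → A ∼₁ B → HasExactlyOne (Common₃ A B)
  ∼₁⇒HasExactlyOne A B (_ , inj₁ (pA∈HB , pB∉HA)) =
    incident-nonincident⇒HasExactlyOne A B pA∈HB pB∉HA
  ∼₁⇒HasExactlyOne A B (_ , inj₂ (pB∈HA , pA∉HB)) =
    let X , X∈ , unique = incident-nonincident⇒HasExactlyOne B A pB∈HA pA∉HB
    in X , swap X∈ , λ Y Y∈ → unique Y (swap Y∈)

  ∼₂⇒HasNone : ∀ A B → A ∼₂ B → HasNone (Common₃ A B)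
  ∼₂⇒HasNone A B (_ , pA∈HB , pB∈HA) X X∈ =
    [ (λ (pA∉HB , _) → pA∉HB pA∈HB) , (λ (pB∉HA , _) → pB∉HA pB∈HA) ]′
      (Common₃⇒crossing A B X (incident⇒skew A B pA∈HB) X∈)

  ∼₄⇒HasExactlyTwo : ∀ A B → A ∼₄ B → HasExactlyTwo (Common₃ A B)
  ∼₄⇒HasExactlyTwo A B (_ , p≉ , H≉ , pA∉HB , pB∉HA) =
    crossing A B pA∉HB , crossing B A pB∉HA ,
    crossing-Common₃ A B skew pA∉HB ,
    swap (crossing-Common₃ B A (Skew-sym A B skew) pB∉HA) ,
    (λ (e , _) → p≉ e) ,
    λ Z Z∈ → map proj₂ proj₂ (Common₃⇒crossing A B Z skew Z∈)
    where
    skew : Skew A B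
    skew = p≉ , H≉

proposition1 : ∀ {c ℓ} (F : Field c ℓ) (n : ℕ) → 3 ≤ n →
    let open ProjectiveSpace F n in
    (A₁ A₂ : AntiFlag) → Distinct A₁ A₂ →
      ((A₁ ∼₁ A₂) → HasExactlyOne (Common₃ A₁ A₂))
      × ((A₁ ∼₂ A₂) → HasNone (Common₃ A₁ A₂))
      × ((A₁ ∼₄ A₂) → HasExactlyTwo (Common₃ A₁ A₂))
proposition1 F n _ A₁ A₂ _ =
  ∼₁⇒HasExactlyOne A₁ A₂ , ∼₂⇒HasNone A₁ A₂ , ∼₄⇒HasExactlyTwo A₁ A₂
  where open AntiFlagProperties F n
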